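{- Let $X\subseteq B$ be an arbitrary set. We have $\mathsf{E}(\Lambda, X) = |\Lambda| |X|$ and $\mathsf{E}(\Lambda^{ -1}, X) \le M^4 |\Lambda| |X|$. In particular, $|B\Lambda| = |B| |\Lambda|$ and $|\Lambda B| \ge |B| |\Lambda|/M^4$.
   Context: Let $p$ be a prime, $M\ge 1$ an integer and $Q=p-1$. For $R\ge 1$ let $F_M(R)$ be the set of rationals $u/v\in[0,1]$, $(u,v)=1$, $v\le R$, whose continued fraction $[0;b_1,\dots,b_s]$ has all partial quotients $b_j\le M$. For $p_s/q_s=[0;b_1,\dots,b_s]$ and $p_{s-1}/q_{s-1}=[0;b_1,\dots,b_{s-1}]$ one has $\prod_{j=1}^s \begin{pmatrix} 0&1\\1&b_j\end{pmatrix} = \begin{pmatrix} p_{s-1}&p_s\\ q_{s-1}&q_s\end{pmatrix}$. Let $\Lambda\subseteq \mathrm{SL}_2(\mathbb{F}_p)$ be the set of such matrices (reduced modulo $p$) coming from elements of $F_M(\sqrt{Q})$ with even $s$. Let $B$ be the standard Borel subgroup of upper-triangular matrices in $\mathrm{SL}_2(\mathbb{F}_p)$. For sets $Y,Z$ of a group, the common energy is $\mathsf{E}(Y,Z)=|\{(y,y_1,z,z_1)\in Y^2\times Z^2 : y^{ -1}z=y_1^{ -1}z_1\}|$. -}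

module Defs where

open import Data.Nat using (ℕ; zero; suc; _+_; _*_; _∸_; _≤_; NonZero)
open import Data.Nat.DivMod using (_mod_)
open import Data.Nat.Primality using (Prime; prime⇒nonZero)
open import Data.Nat.Properties using ()
open import Data.Fin using (Fin; toℕ)
open import Data.List using (List; []; _∷_; length)
open import Data.List.Relation.Unary.All using (All)
open import Data.List.Relation.Unary.Unique.Propositional using (Unique)
open import Data.List.Membership.Propositional using (_∈_)
open import Data.Product using (Σ; ∃; _×_; _,_)
open import Function.Bundles using (_⇔_)
open import Relation.Binary.PropositionalEquality using (_≡_)

record M2 (A : Set) : Set where
  constructor mat
  field
    a b c d : A

open M2 public

mulℕ : M2 ℕ → M2 ℕ → M2 ℕ
mulℕ (mat a b c d) (mat a' b' c' d') =
  mat (a * a' + b * c') (a * b' + b * d') (c * a' + d * c') (c * b' + d * d')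

idℕ : M2 ℕ
idℕ = mat 1 0 0 1

cfMat : ℕ → M2 ℕ
cfMat b = mat 0 1 1 b

-- product  ∏_{j=1}^{s} ( 0 1 ; 1 b_j )  =  ( p_{s-1} p_s ; q_{s-1} q_s )
cfProd : List ℕ → M2 ℕ
cfProd []       = idℕ
cfProd (b ∷ bs) = mulℕ (cfMat b) (cfProd bs)

-- q_s, the denominator of [0; b_1, ..., b_s]
cfDen : List ℕ → ℕ
cfDen bs = d (cfProd bs)

data Even : ℕ → Set where
  even-zero : Even zero
  even-ss   : ∀ {n} → Even n → Even (suc (suc n))

Card : {A : Set} → (A → Set) → ℕ → Set
Card {A} S n = Σ (List A) λ l → Unique l × (∀ x → (x ∈ l) ⇔ S x) × length l ≡ n

module OverFp (p : ℕ) (pp : Prime p) where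

  private
    instance
      nz : NonZero p
      nz = prime⇒nonZero pp

  Fp : Set
  Fp = Fin p

  red : ℕ → Fp
  red n = n mod p

  _+ₚ_ _*ₚ_ : Fp → Fp → Fp
  x +ₚ y = red (toℕ x + toℕ y)
  x *ₚ y = red (toℕ x * toℕ y)

  -ₚ_ : Fp → Fp
  -ₚ x = red (p ∸ toℕ x)

  0ₚ 1ₚ : Fp
  0ₚ = red 0
  1ₚ = red 1

  Mat : Set
  Mat = M2 Fp

  _·_ : Mat → Mat → Mat
  mat a b c d · mat a' b' c' d' =
    mat ((a *ₚ a') +ₚ (b *ₚ c')) ((a *ₚ b') +ₚ (b *ₚ d'))
        ((c *ₚ a') +ₚ (d *ₚ c')) ((c *ₚ b') +ₚ (d *ₚ d'))

  det : Mat → Fp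
  det (mat a b c d) = (a *ₚ d) +ₚ (-ₚ (b *ₚ c))

  -- inverse in SL_2(F_p) (the adjugate; equals the inverse when det = 1)
  inv : Mat → Mat
  inv (mat a b c d) = mat d (-ₚ b) (-ₚ c) a

  redMat : M2 ℕ → Mat
  redMat (mat a b c d) = mat (red a) (red b) (red c) (red d)

  SL2 : Mat → Set
  SL2 g = det g ≡ 1ₚ

  Borel : Mat → Set
  Borel g = SL2 g × c g ≡ 0ₚ

  Q : ℕ
  Q = p ∸ 1

  -- admissible sequences of partial quotients: 1 ≤ b_j ≤ M, s even,
  -- q_s ≤ √Q  (i.e. q_s² ≤ Q)
  Admissible : ℕ → List ℕ → Set
  Admissible M bs =
    All (λ b → 1 ≤ b × b ≤ M) bs × Even (length bs) × cfDen bs * cfDen bs ≤ Q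

  Λ : ℕ → Mat → Set
  Λ M g = ∃ λ bs → Admissible M bs × redMat (cfProd bs) ≡ g

  InvSet : (Mat → Set) → Mat → Set
  InvSet Y g = ∃ λ y → Y y × inv y ≡ g

  ProdSet : (Mat → Set) → (Mat → Set) → Mat → Set
  ProdSet Y Z g = ∃ λ y → ∃ λ z → Y y × Z z × y · z ≡ g

  EnergySet : (Mat → Set) → (Mat → Set) → Mat × Mat × Mat × Mat → Set
  EnergySet Y Z (y , y₁ , z , z₁) =
    Y y × Y y₁ × Z z × Z z₁ × inv y · z ≡ inv y₁ · z₁

module Submission where

open import Defs
open import Data.Nat using (ℕ)
open import Data.Nat.Primality using (Prime)

-- An element of Λ is the reduction mod p of ( p_{s-1} p_s ; q_{s-1} q_s ),
-- whose entries are at most q_s ≤ √(p - 1).  Multiplying by an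
-- upper-triangular z ∈ B on the left rescales its bottom row, on the right
-- its first column.  As the entries are below √p, proportionality of two such
-- rows (or columns) mod p is proportionality over ℤ, and as they are
-- primitive (the determinant is 1) it is equality.  The bottom row
-- (q_{s-1} , q_s) determines an even-length expansion, and the first column
-- (p_{s-1} , q_{s-1}) determines it up to its last quotient b_s ∈ {1, …, M}.
-- So (z , g) ↦ z g is injective on B × Λ and (g , z) ↦ g z is at most
-- M-to-one; the energy equation y⁻¹ z = y₁⁻¹ z₁ reduces to the first fact
-- after inversion, and for y = g⁻¹ to the second.  The four claims follow by
-- counting along injections, weakening M to M⁴.

module Counting where

  open import Data.Nat using (ℕ; suc; _+_; _*_; _≤_; _<_; z≤n; s≤s)
  import Data.Nat.Properties as ℕₚ
  open import Data.List using (List; []; _∷_; _++_; length; map; cartesianProduct; upTo)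
  import Data.List.Properties as Listₚ
  import Data.List.Relation.Unary.All as All
  open import Data.List.Relation.Unary.AllPairs using ([]; _∷_)
  open import Data.List.Relation.Unary.Any using (here; there)
  open import Data.List.Relation.Unary.Unique.Propositional using (Unique)
  import Data.List.Relation.Unary.Unique.Propositional.Properties as Uniqueₚ
  open import Data.List.Membership.Propositional using (_∈_)
  import Data.List.Membership.Propositional.Properties as ∈ₚ
  open import Data.Product using (_×_; _,_; ∃₂)
  open import Data.Sum using (inj₁; inj₂)
  open import Function using (_∘_)
  open import Function.Bundles using (_⇔_; mk⇔; Equivalence)
  open import Relation.Binary.PropositionalEquality
  open import Relation.Nullary using (contradiction)

  private
    variable
      A B : Set
      n m : ℕ

  unique-⊆⇒length-≤ : (xs ys : List A) → Unique xs → (∀ {x} → x ∈ xs → x ∈ ys) →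
                      length xs ≤ length ys
  unique-⊆⇒length-≤ []       ys _          _     = z≤n
  unique-⊆⇒length-≤ (x ∷ xs) ys (x∉ ∷ !xs) xs⊆ys
    with us , vs , refl ← ∈ₚ.∈-∃++ (xs⊆ys (here refl)) = begin
      suc (length xs)             ≤⟨ s≤s (unique-⊆⇒length-≤ xs (us ++ vs) !xs xs⊆us++vs) ⟩
      suc (length (us ++ vs))     ≡⟨ cong suc (Listₚ.length-++ us) ⟩
      suc (length us + length vs) ≡⟨ ℕₚ.+-suc (length us) (length vs) ⟨
      length us + length (x ∷ vs) ≡⟨ Listₚ.length-++ us ⟨
      length (us ++ x ∷ vs)       ∎
    where
    open ℕₚ.≤-Reasoning
    xs⊆us++vs : ∀ {y} → y ∈ xs → y ∈ us ++ vs
    xs⊆us++vs y∈xs with ∈ₚ.∈-++⁻ us (xs⊆ys (there y∈xs))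
    ... | inj₁ y∈us         = ∈ₚ.∈-++⁺ˡ y∈us
    ... | inj₂ (here refl)  = contradiction refl (All.lookup x∉ y∈xs)
    ... | inj₂ (there y∈vs) = ∈ₚ.∈-++⁺ʳ us y∈vs

  -- An injection of the predicate S into the predicate T: a map on the elements
  -- of S (which may use their membership proofs) landing in T, whose value
  -- determines the element.
  record _↪_ (S : A → Set) (T : B → Set) : Set where
    field
      to        : ∀ x → S x → B
      to-∈      : ∀ x (s : S x) → T (to x s)
      injective : ∀ {x x′} (s : S x) (s′ : S x′) → to x s ≡ to x′ s′ → x ≡ x′

  module _ {S : A → Set} {T : B → Set} (S↪T : S ↪ T) where
    open _↪_ S↪T

    InS : List A → Set
    InS xs = ∀ {x} → x ∈ xs → S x

    image : (xs : List A) → InS xs → List B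
    image []       _ = []
    image (x ∷ xs) h = to x (h (here refl)) ∷ image xs (h ∘ there)

    length-image : ∀ xs (h : InS xs) → length (image xs h) ≡ length xs
    length-image []       _ = refl
    length-image (x ∷ xs) h = cong suc (length-image xs (h ∘ there))

    image-⊆ : ∀ xs (h : InS xs) {y} → y ∈ image xs h → ∃₂ λ x (x∈xs : x ∈ xs) → y ≡ to x (h x∈xs)
    image-⊆ (x ∷ xs) h (here y≡) = x , here refl , y≡
    image-⊆ (x ∷ xs) h (there y∈) with x′ , x′∈ , y≡ ← image-⊆ xs (h ∘ there) y∈ =
      x′ , there x′∈ , y≡

    image-unique : ∀ xs (h : InS xs) → Unique xs → Unique (image xs h)
    image-unique []       _ _          = []
    image-unique (x ∷ xs) h (x∉ ∷ !xs) =
      All.tabulate fresh ∷ image-unique xs (h ∘ there) !xs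
      where
      fresh : ∀ {y} → y ∈ image xs (h ∘ there) → to x (h (here refl)) ≢ y
      fresh y∈ eq with x′ , x′∈ , refl ← image-⊆ xs (h ∘ there) y∈ =
        All.lookup x∉ x′∈ (injective _ _ eq)

    card-mono : Card S n → Card T m → n ≤ m
    card-mono (xs , !xs , xs⇔S , refl) (ys , _ , ys⇔T , refl) = begin
      length xs             ≡⟨ length-image xs member ⟨
      length (image xs member) ≤⟨ unique-⊆⇒length-≤ _ ys (image-unique xs member !xs) image⊆ys ⟩
      length ys             ∎
      where
      open ℕₚ.≤-Reasoning
      member : InS xs
      member = Equivalence.to (xs⇔S _)
      image⊆ys : ∀ {y} → y ∈ image xs member → y ∈ ys
      image⊆ys y∈ with x , x∈ , refl ← image-⊆ xs member y∈ =
        Equivalence.from (ys⇔T _) (to-∈ x (member x∈))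

  length-cartesianProduct : (xs : List A) (ys : List B) →
                            length (cartesianProduct xs ys) ≡ length xs * length ys
  length-cartesianProduct []       ys = refl
  length-cartesianProduct (x ∷ xs) ys = begin
    length (map (x ,_) ys ++ cartesianProduct xs ys)
      ≡⟨ Listₚ.length-++ (map (x ,_) ys) ⟩
    length (map (x ,_) ys) + length (cartesianProduct xs ys)
      ≡⟨ cong₂ _+_ (Listₚ.length-map (x ,_) ys) (length-cartesianProduct xs ys) ⟩
    length ys + length xs * length ys
      ∎
    where open ≡-Reasoning

  _⊠_ : (A → Set) → (B → Set) → A × B → Set
  (S ⊠ T) (x , y) = S x × T y

  card-⊠ : {S : A → Set} {T : B → Set} → Card S n → Card T m → Card (S ⊠ T) (n * m)
  card-⊠ {S = S} {T} (xs , !xs , xs⇔S , refl) (ys , !ys , ys⇔T , refl) =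
    cartesianProduct xs ys , Uniqueₚ.cartesianProduct⁺ !xs !ys , members ,
    length-cartesianProduct xs ys
    where
    members : ∀ q → (q ∈ cartesianProduct xs ys) ⇔ (S ⊠ T) q
    members (x , y) = mk⇔
      (λ q∈ → let x∈ , y∈ = ∈ₚ.∈-cartesianProduct⁻ xs ys q∈ in
              Equivalence.to (xs⇔S x) x∈ , Equivalence.to (ys⇔T y) y∈)
      (λ (s , t) → ∈ₚ.∈-cartesianProduct⁺ (Equivalence.from (xs⇔S x) s) (Equivalence.from (ys⇔T y) t))

  card-below : ∀ M → Card (_< M) M
  card-below M = upTo M , Uniqueₚ.upTo⁺ M , (λ k → mk⇔ ∈ₚ.∈-upTo⁻ ∈ₚ.∈-upTo⁺) , Listₚ.length-upTo M

module ContinuedFractions where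

  open import Data.Bool using (Bool; true; false; not)
  open import Data.Bool.Properties using (not-injective)
  open import Data.Nat using (ℕ; zero; suc; _+_; _*_; _∸_; _≤_; _<_; z≤n; s≤s; >-nonZero)
  import Data.Nat.Properties as ℕₚ
  open import Data.Nat.DivMod using (_%_; [m+kn]%n≡m%n; m<n⇒m%n≡m)
  open import Data.Nat.Tactic.RingSolver using (solve-∀)
  open import Data.List using (List; []; _∷_; [_]; _∷ʳ_; length; foldr; foldl; reverse; initLast; _∷ʳ′_)
  import Data.List.Properties as Listₚ
  open import Data.List.Relation.Unary.All using (All; []; _∷_)
  import Data.List.Relation.Unary.All as All
  import Data.List.Relation.Unary.All.Properties as Allₚ
  import Data.List.Relation.Unary.Any.Properties as Anyₚ
  open import Data.Product using (_×_; _,_; proj₁; proj₂)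
  open import Data.Sum using (_⊎_; inj₁; inj₂)
  open import Function using (_∘_; flip)
  open import Relation.Binary.PropositionalEquality hiding ([_])
  open import Relation.Nullary using (contradiction)
  open import Data.Nat.Divisibility using (_∣_; ∣-antisym; ∣1⇒≡1; ∣m+n∣m⇒∣n; ∣n⇒∣m*n; m∣m*n; ∣-refl)
  open import Data.Nat.Coprimality using (Coprime; coprime-divisor)
  import Data.Nat.Coprimality as Coprime

  Pair : Set
  Pair = ℕ × ℕ

  -- One step of the continuant recursion: prepending the partial quotient b
  -- maps a column (x , y) of the product of the matrices (0 1 ; 1 b_j) to
  -- (y , x + b y), since (0 1 ; 1 b) (x ; y) = (y ; x + b y).
  step : ℕ → Pair → Pair
  step b (x , y) = y , x + b * y

  -- the column (x , y) multiplied by (0 1 ; 1 b_1) ⋯ (0 1 ; 1 b_s)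
  column : Pair → List ℕ → Pair
  column = foldr step

  fromColumns : Pair → Pair → M2 ℕ
  fromColumns (a , c) (b , d) = mat a b c d

  -- For bs = [b_1, …, b_s] the product ∏ (0 1 ; 1 b_j) has the columns
  -- (p_{s-1} , q_{s-1}) = column (1 , 0) bs and (p_s , q_s) = column (0 , 1) bs.
  cf : List ℕ → M2 ℕ
  cf bs = fromColumns (column (1 , 0) bs) (column (0 , 1) bs)

  cfProd≡cf : ∀ bs → cfProd bs ≡ cf bs
  cfProd≡cf []       = refl
  cfProd≡cf (x ∷ bs) rewrite cfProd≡cf bs =
    cong₂ fromColumns (cong₂ _,_ (ℕₚ.+-identityʳ q′) (cong (_+ x * q′) (ℕₚ.+-identityʳ p′)))
                      (cong₂ _,_ (ℕₚ.+-identityʳ q) (cong (_+ x * q) (ℕₚ.+-identityʳ p)))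
    where open M2 (cf bs) renaming (a to p′; b to p; c to q′; d to q)

  Positive : List ℕ → Set
  Positive = All (1 ≤_)

  Unimodular : Pair → Pair → Set
  Unimodular (a , c) (b , d) = a * d ≡ b * c + 1

  -- A step multiplies by (0 1 ; 1 b), of determinant -1, so it exchanges the
  -- roles of the two columns.
  step-swap : ∀ b u v → Unimodular u v → Unimodular (step b v) (step b u)
  step-swap b (a , c) (b′ , d) det = begin
    d * (a + b * c)      ≡⟨ expand-l a c d b ⟩
    a * d + b * c * d    ≡⟨ cong (_+ b * c * d) det ⟩
    b′ * c + 1 + b * c * d ≡⟨ expand-r b′ c d b ⟩
    c * (b′ + b * d) + 1 ∎
    where
    open ≡-Reasoning
    expand-l : ∀ a c d b → d * (a + b * c) ≡ a * d + b * c * d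
    expand-l = solve-∀
    expand-r : ∀ b′ c d b → b′ * c + 1 + b * c * d ≡ c * (b′ + b * d) + 1
    expand-r = solve-∀

  column-unimodular : ∀ u v bs → Even (length bs) → Unimodular u v →
                      Unimodular (column u bs) (column v bs)
  column-unimodular u v []           even-zero      det = det
  column-unimodular u v (x ∷ y ∷ bs) (even-ss even) det =
    step-swap x (column v (y ∷ bs)) (column u (y ∷ bs))
      (step-swap y (column u bs) (column v bs) (column-unimodular u v bs even det))

  cf-det : ∀ bs → Even (length bs) → a (cf bs) * d (cf bs) ≡ b (cf bs) * c (cf bs) + 1
  cf-det bs even = column-unimodular (1 , 0) (0 , 1) bs even refl

  _≤₂_ : Pair → Pair → Set
  (x , y) ≤₂ (x′ , y′) = x ≤ x′ × y ≤ y′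

  step-mono : ∀ b u v → u ≤₂ v → step b u ≤₂ step b v
  step-mono b u v (x≤ , y≤) = y≤ , ℕₚ.+-mono-≤ x≤ (ℕₚ.*-monoʳ-≤ b y≤)

  step-increasing : ∀ {b} (w : Pair) → 1 ≤ b → proj₁ (step b w) ≤ proj₂ (step b w)
  step-increasing {b} (x , y) 1≤b =
    ℕₚ.≤-trans (ℕₚ.m≤n*m y b) (ℕₚ.m≤n+m (b * y) x)
    where instance _ = >-nonZero 1≤b

  columns-ordered : ∀ x bs → Positive (x ∷ bs) → column (1 , 0) (x ∷ bs) ≤₂ column (0 , 1) (x ∷ bs)
  columns-ordered x []       (1≤x ∷ []) =
    z≤n , subst₂ _≤_ (cong suc (sym (ℕₚ.*-zeroʳ x))) (sym (ℕₚ.*-identityʳ x)) 1≤x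
  columns-ordered x (y ∷ bs) (_ ∷ pos) =
    step-mono x (column (1 , 0) (y ∷ bs)) (column (0 , 1) (y ∷ bs)) (columns-ordered y bs pos)

  cf-entries≤q : ∀ bs → Positive bs → a (cf bs) ≤ d (cf bs) × c (cf bs) ≤ d (cf bs)
  cf-entries≤q []       _               = s≤s z≤n , z≤n
  cf-entries≤q (x ∷ bs) pos@(1≤x ∷ _) =
    ℕₚ.≤-trans (step-increasing (column (1 , 0) bs) 1≤x) c≤d , c≤d
    where
    c≤d : c (cf (x ∷ bs)) ≤ d (cf (x ∷ bs))
    c≤d = proj₂ (columns-ordered x bs pos)

  -- The expansions [… , b , 1] and [… , b + 1] of the same fraction have
  -- lengths of different parity, so the parity removes the ambiguity; an even
  -- length has parity true.
  isEven : ℕ → Bool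
  isEven zero    = true
  isEven (suc n) = not (isEven n)

  even⇒isEven : ∀ {n} → Even n → isEven n ≡ true
  even⇒isEven even-zero     = refl
  even⇒isEven (even-ss e) rewrite even⇒isEven e = refl

  convergent : List ℕ → Pair
  convergent = column (0 , 1)

  q≥1 : ∀ bs → Positive bs → 1 ≤ proj₂ (convergent bs)
  q≥1 []       _           = s≤s z≤n
  q≥1 (x ∷ bs) (1≤x ∷ pos) =
    ℕₚ.≤-trans (ℕₚ.*-mono-≤ 1≤x (q≥1 bs pos)) (ℕₚ.m≤n+m (x * proj₂ (convergent bs)) _)

  p≡0⇒empty : ∀ bs → Positive bs → proj₁ (convergent bs) ≡ 0 → bs ≡ []
  p≡0⇒empty []       _         _   = refl
  p≡0⇒empty (x ∷ bs) (_ ∷ pos) p≡0 = contradiction p≡0 (ℕₚ.m<n⇒n≢0 (q≥1 bs pos))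

  p<q : ∀ bs → Positive bs → bs ≡ [ 1 ] ⊎ proj₁ (convergent bs) < proj₂ (convergent bs)
  p<q []                _         = inj₂ (s≤s z≤n)
  p<q (0 ∷ _)           (() ∷ _)
  p<q (1 ∷ [])          _         = inj₁ refl
  p<q (1 ∷ y ∷ bs)      (_ ∷ _ ∷ pos) =
    inj₂ (ℕₚ.+-mono-≤ (q≥1 bs pos) (ℕₚ.≤-reflexive (sym (ℕₚ.*-identityˡ _))))
  p<q (suc (suc k) ∷ bs) (_ ∷ pos) = inj₂ (begin-strict
    Y                   <⟨ ℕₚ.+-monoˡ-≤ Y (q≥1 bs pos) ⟩
    Y + Y               ≤⟨ ℕₚ.+-monoʳ-≤ Y (ℕₚ.m≤m+n Y (k * Y)) ⟩
    suc (suc k) * Y     ≤⟨ ℕₚ.m≤n+m _ X ⟩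
    X + suc (suc k) * Y ∎)
    where
    open ℕₚ.≤-Reasoning
    X Y : ℕ
    X = proj₁ (convergent bs)
    Y = proj₂ (convergent bs)

  division-unique : ∀ {r r′ q q′ y} → r < y → r′ < y → r + q * y ≡ r′ + q′ * y → q ≡ q′ × r ≡ r′
  division-unique {r} {r′} {q} {q′} {y@(suc _)} r<y r′<y eq =
    ℕₚ.*-cancelʳ-≡ q q′ y (ℕₚ.+-cancelˡ-≡ r _ _ (trans eq (cong (_+ q′ * y) (sym r≡r′)))) , r≡r′
    where
    open ≡-Reasoning
    r≡r′ : r ≡ r′
    r≡r′ = begin
      r                ≡⟨ m<n⇒m%n≡m r<y ⟨
      r % y            ≡⟨ [m+kn]%n≡m%n r q y ⟨
      (r + q * y) % y  ≡⟨ cong (_% y) eq ⟩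
      (r′ + q′ * y) % y ≡⟨ [m+kn]%n≡m%n r′ q′ y ⟩
      r′ % y           ≡⟨ m<n⇒m%n≡m r′<y ⟩
      r′               ∎

  below-one : ∀ bs → Positive bs → proj₂ (convergent bs) ≡ 1 →
              proj₁ (convergent bs) < proj₂ (convergent bs) → bs ≡ []
  below-one bs pos q≡1 p<q = p≡0⇒empty bs pos (ℕₚ.n<1⇒n≡0 (subst (proj₁ (convergent bs) <_) q≡1 p<q))

  -- An expansion with positive quotients is determined by (p_s , q_s) and the
  -- parity of its length: peel off the first quotient as the integer part of
  -- q_s / p_s (Euclid's algorithm), treating the ambiguous tail [1] separately.
  convergent-injective : ∀ bs bs′ → Positive bs → Positive bs′ →
                         isEven (length bs) ≡ isEven (length bs′) →
                         convergent bs ≡ convergent bs′ → bs ≡ bs′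
  convergent-injective []       []        _ _          _ _  = refl
  convergent-injective []       (x ∷ bs′) _ (_ ∷ pos′) _ eq =
    contradiction (sym (cong proj₁ eq)) (ℕₚ.m<n⇒n≢0 (q≥1 bs′ pos′))
  convergent-injective (x ∷ bs) []        (_ ∷ pos) _  _ eq =
    contradiction (cong proj₁ eq) (ℕₚ.m<n⇒n≢0 (q≥1 bs pos))
  convergent-injective (x ∷ bs) (x′ ∷ bs′) (_ ∷ pos) (_ ∷ pos′) parity eq
    with p<q bs pos | p<q bs′ pos′
  ... | inj₁ refl | inj₁ refl =
    cong (_∷ [ 1 ]) (ℕₚ.*-cancelʳ-≡ x x′ 1 (ℕₚ.+-cancelˡ-≡ 1 _ _ (cong proj₂ eq)))
  ... | inj₁ refl | inj₂ p<q′ with refl ← below-one bs′ pos′ (sym (cong proj₁ eq)) p<q′ =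
    contradiction parity λ ()
  ... | inj₂ p<q  | inj₁ refl with refl ← below-one bs pos (cong proj₁ eq) p<q =
    contradiction parity λ ()
  ... | inj₂ p<q  | inj₂ p<q′ =
    cong₂ _∷_ (proj₁ quotients)
      (convergent-injective bs bs′ pos pos′ (not-injective parity) (cong₂ _,_ (proj₂ quotients) q≡q′))
    where
    p p′ q q′ : ℕ
    p = proj₁ (convergent bs)
    p′ = proj₁ (convergent bs′)
    q = proj₂ (convergent bs)
    q′ = proj₂ (convergent bs′)
    q≡q′ : q ≡ q′
    q≡q′ = cong proj₁ eq
    -- x and x′ are the integer parts of the same quotient, with remainders p, p′
    quotients : x ≡ x′ × p ≡ p′
    quotients = division-unique p<q (subst (p′ <_) (sym q≡q′) p<q′)
                  (trans (cong proj₂ eq) (cong (λ y → p′ + x′ * y) (sym q≡q′)))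

  row-times-cf : ∀ bs u v → (u * a (cf bs) + v * c (cf bs) , u * b (cf bs) + v * d (cf bs))
                            ≡ foldl (flip step) (u , v) bs
  row-times-cf []       u v = cong₂ _,_ (unit-l u v) (unit-r u v)
    where
    unit-l : ∀ u v → u * 1 + v * 0 ≡ u
    unit-l = solve-∀
    unit-r : ∀ u v → u * 0 + v * 1 ≡ v
    unit-r = solve-∀
  row-times-cf (x ∷ bs) u v =
    trans (cong₂ _,_ (regroup u v x (a (cf bs)) (c (cf bs))) (regroup u v x (b (cf bs)) (d (cf bs))))
          (row-times-cf bs v (u + x * v))
    where
    regroup : ∀ u v x a c → u * c + v * (a + x * c) ≡ v * a + (u + x * v) * c
    regroup = solve-∀

  bottom-row : ∀ bs → (c (cf bs) , d (cf bs)) ≡ convergent (reverse bs)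
  bottom-row bs = begin
    (c (cf bs) , d (cf bs))                          ≡⟨ cong₂ _,_ (ℕₚ.+-identityʳ _) (ℕₚ.+-identityʳ _) ⟨
    (0 * a (cf bs) + 1 * c (cf bs) , 0 * b (cf bs) + 1 * d (cf bs)) ≡⟨ row-times-cf bs 0 1 ⟩
    foldl (flip step) (0 , 1) bs                     ≡⟨ Listₚ.reverse-foldr step (0 , 1) bs ⟨
    convergent (reverse bs)                          ∎
    where open ≡-Reasoning

  positive-reverse : ∀ {bs} → Positive bs → Positive (reverse bs)
  positive-reverse pos = All.tabulate (All.lookup pos ∘ Anyₚ.reverse⁻)

  bottom-row-determines : ∀ bs bs′ → Positive bs → Positive bs′ →
                          Even (length bs) → Even (length bs′) →
                          (c (cf bs) , d (cf bs)) ≡ (c (cf bs′) , d (cf bs′)) → bs ≡ bs′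
  bottom-row-determines bs bs′ pos pos′ even even′ rows =
    Listₚ.reverse-injective (convergent-injective (reverse bs) (reverse bs′)
      (positive-reverse pos) (positive-reverse pos′) parity
      (trans (sym (bottom-row bs)) (trans rows (bottom-row bs′))))
    where
    parity : isEven (length (reverse bs)) ≡ isEven (length (reverse bs′))
    parity = begin
      isEven (length (reverse bs))  ≡⟨ cong isEven (Listₚ.length-reverse bs) ⟩
      isEven (length bs)            ≡⟨ even⇒isEven even ⟩
      true                          ≡⟨ even⇒isEven even′ ⟨
      isEven (length bs′)           ≡⟨ cong isEven (Listₚ.length-reverse bs′) ⟨
      isEven (length (reverse bs′)) ∎
      where open ≡-Reasoning

  first-column-∷ʳ : ∀ xs z → column (1 , 0) (xs ∷ʳ z) ≡ convergent xs
  first-column-∷ʳ xs z =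
    trans (Listₚ.foldr-∷ʳ step (1 , 0) z xs)
          (cong (λ w → column (0 , w) xs) (cong suc (ℕₚ.*-zeroʳ z)))

  -- b_s - 1, the position of the last quotient b_s ∈ {1, …, M} (0 for the
  -- empty expansion), read off after appending a quotient, and below M.
  lastIndex : List ℕ → ℕ
  lastIndex []          = 0
  lastIndex (x ∷ [])    = x ∸ 1
  lastIndex (x ∷ y ∷ r) = lastIndex (y ∷ r)

  lastIndex-∷ʳ : ∀ xs z → lastIndex (xs ∷ʳ z) ≡ z ∸ 1
  lastIndex-∷ʳ []          z = refl
  lastIndex-∷ʳ (x ∷ [])    z = refl
  lastIndex-∷ʳ (x ∷ y ∷ r) z = lastIndex-∷ʳ (y ∷ r) z

  lastIndex<M : ∀ {M} bs → 1 ≤ M → All (λ b → 1 ≤ b × b ≤ M) bs → lastIndex bs < M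
  lastIndex<M []            1≤M _                  = 1≤M
  lastIndex<M (suc x ∷ [])  _   ((_ , x<M) ∷ [])   = x<M
  lastIndex<M (x ∷ y ∷ r)   1≤M (_ ∷ bounds)       = lastIndex<M (y ∷ r) 1≤M bounds

  odd-init : ∀ (xs : List ℕ) z → Even (length (xs ∷ʳ z)) → isEven (length xs) ≡ false
  odd-init xs z even = not-injective (begin
    isEven (suc (length xs))    ≡⟨ cong isEven (ℕₚ.+-comm 1 (length xs)) ⟩
    isEven (length xs + 1)      ≡⟨ cong isEven (Listₚ.length-++ xs {[ z ]}) ⟨
    isEven (length (xs ∷ʳ z))   ≡⟨ even⇒isEven even ⟩
    true                        ∎)
    where open ≡-Reasoning

  -- A positive even-length expansion is determined by its first column and its
  -- last quotient: the first column is (p , q) of the expansion without its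
  -- last quotient, which has odd length.
  first-column-determines : ∀ bs bs′ → Positive bs → Positive bs′ →
                            Even (length bs) → Even (length bs′) →
                            column (1 , 0) bs ≡ column (1 , 0) bs′ →
                            lastIndex bs ≡ lastIndex bs′ → bs ≡ bs′
  first-column-determines bs bs′ pos pos′ even even′ cols last
    with initLast bs | initLast bs′
  ... | []       | []         = refl
  ... | []       | xs′ ∷ʳ′ z′ =
    contradiction (trans (cong proj₂ cols) (cong proj₂ (first-column-∷ʳ xs′ z′)))
                  (ℕₚ.m<n⇒n≢0 (q≥1 xs′ (proj₁ (Allₚ.∷ʳ⁻ pos′))) ∘ sym)
  ... | xs ∷ʳ′ z | []         =
    contradiction (trans (sym (cong proj₂ (first-column-∷ʳ xs z))) (cong proj₂ cols))
                  (ℕₚ.m<n⇒n≢0 (q≥1 xs (proj₁ (Allₚ.∷ʳ⁻ pos))))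
  ... | xs ∷ʳ′ z | xs′ ∷ʳ′ z′ = cong₂ _∷ʳ_ xs≡xs′ z≡z′
    where
    xs≡xs′ : xs ≡ xs′
    xs≡xs′ = convergent-injective xs xs′ (proj₁ (Allₚ.∷ʳ⁻ pos)) (proj₁ (Allₚ.∷ʳ⁻ pos′))
               (trans (odd-init xs z even) (sym (odd-init xs′ z′ even′)))
               (trans (sym (first-column-∷ʳ xs z)) (trans cols (first-column-∷ʳ xs′ z′)))
    z≡z′ : z ≡ z′
    z≡z′ = begin
      z         ≡⟨ ℕₚ.m∸n+n≡m (proj₂ (Allₚ.∷ʳ⁻ pos)) ⟨
      z ∸ 1 + 1 ≡⟨ cong (_+ 1) (trans (sym (lastIndex-∷ʳ xs z)) (trans last (lastIndex-∷ʳ xs′ z′))) ⟩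
      z′ ∸ 1 + 1 ≡⟨ ℕₚ.m∸n+n≡m (proj₂ (Allₚ.∷ʳ⁻ pos′)) ⟩
      z′        ∎
      where open ≡-Reasoning

  unimodular⇒coprime : ∀ {x y m n} → x * m ≡ y * n + 1 → Coprime m n
  unimodular⇒coprime {x} {y} eq {k} (k∣m , k∣n) =
    ∣1⇒≡1 (∣m+n∣m⇒∣n (subst (k ∣_) eq (∣n⇒∣m*n x k∣m)) (∣n⇒∣m*n y k∣n))

  coprime-proportional : ∀ {x y x′ y′} → Coprime x y → Coprime x′ y′ →
                         x * y′ ≡ x′ * y → x ≡ x′ × y ≡ y′
  coprime-proportional {x} {y} {x′} {y′} coprime coprime′ cross =
    ∣-antisym (coprime-divisor coprime x∣yx′) (coprime-divisor coprime′ x′∣y′x) ,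
    ∣-antisym (coprime-divisor (Coprime.sym coprime) y∣xy′) (coprime-divisor (Coprime.sym coprime′) y′∣x′y)
    where
    x∣yx′ : x ∣ y * x′
    x∣yx′ = subst (x ∣_) (trans cross (ℕₚ.*-comm x′ y)) (m∣m*n y′)
    x′∣y′x : x′ ∣ y′ * x
    x′∣y′x = subst (x′ ∣_) (trans (sym cross) (ℕₚ.*-comm x y′)) (m∣m*n y)
    y∣xy′ : y ∣ x * y′
    y∣xy′ = subst (y ∣_) (sym cross) (∣n⇒∣m*n x′ (∣-refl {y}))
    y′∣x′y : y′ ∣ x′ * y
    y′∣x′y = subst (y′ ∣_) cross (∣n⇒∣m*n x (∣-refl {y′}))

module Residues (p : ℕ) (pp : Prime p) where

  open import Data.Nat using (ℕ; zero; suc; _<_; _≤_; NonZero)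
  import Data.Nat as ℕ
  import Data.Nat.Properties as ℕₚ
  open import Data.Nat.DivMod using (_%_; _/_; m≡m%n+[m/n]*n; m%n<n)
  open import Data.Nat.Primality using (Prime; prime⇒nonZero)
  open import Data.Integer using (ℤ; +_; +[1+_]; -[1+_]; _+_; _*_; -_; _-_; 0ℤ; 1ℤ)
  import Data.Integer.Properties as ℤₚ
  open import Data.Integer.Tactic.RingSolver using (solve-∀)
  open import Data.Fin using (toℕ)
  import Data.Fin.Properties as Finₚ
  open import Data.Product using (_×_; _,_; proj₂)
  open import Relation.Binary.Bundles using (Setoid)
  import Relation.Binary.Reasoning.Setoid as SetoidReasoning
  open import Relation.Binary.PropositionalEquality
  open import Relation.Nullary using (contradiction)

  open OverFp p pp

  private
    instance
      p≢0 : NonZero p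
      p≢0 = prime⇒nonZero pp

  P : ℤ
  P = + p

  infix 4 _≈_
  infix 1 _by_
  record _≈_ (x y : ℤ) : Set where
    constructor _by_
    field
      multiple : ℤ
      difference : x ≡ y + multiple * P

  ≈-refl : ∀ {x} → x ≈ x
  ≈-refl {x} = 0ℤ by shift x P
    where
    shift : ∀ x P → x ≡ x + 0ℤ * P
    shift = solve-∀

  ≡⇒≈ : ∀ {x y} → x ≡ y → x ≈ y
  ≡⇒≈ refl = ≈-refl

  ≈-sym : ∀ {x y} → x ≈ y → y ≈ x
  ≈-sym {y = y} (k by refl) = (- k) by shift y k P
    where
    shift : ∀ y k P → y ≡ (y + k * P) + (- k) * P
    shift = solve-∀

  ≈-trans : ∀ {x y z} → x ≈ y → y ≈ z → x ≈ z
  ≈-trans {z = z} (k by refl) (l by refl) = l + k by shift z k l P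
    where
    shift : ∀ z k l P → (z + l * P) + k * P ≡ z + (l + k) * P
    shift = solve-∀

  ≈-setoid : Setoid _ _
  ≈-setoid = record { Carrier = ℤ ; _≈_ = _≈_
                    ; isEquivalence = record { refl = ≈-refl ; sym = ≈-sym ; trans = ≈-trans } }

  +-cong : ∀ {x x′ y y′} → x ≈ x′ → y ≈ y′ → x + y ≈ x′ + y′
  +-cong {x′ = x′} {y′ = y′} (k by refl) (l by refl) = k + l by shift x′ y′ k l P
    where
    shift : ∀ x′ y′ k l P → (x′ + k * P) + (y′ + l * P) ≡ (x′ + y′) + (k + l) * P
    shift = solve-∀

  *-cong : ∀ {x x′ y y′} → x ≈ x′ → y ≈ y′ → x * y ≈ x′ * y′
  *-cong {x′ = x′} {y′ = y′} (k by refl) (l by refl) =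
    k * y′ + x′ * l + k * l * P by shift x′ y′ k l P
    where
    shift : ∀ x′ y′ k l P → (x′ + k * P) * (y′ + l * P) ≡ x′ * y′ + (k * y′ + x′ * l + k * l * P) * P
    shift = solve-∀

  neg-cong : ∀ {x x′} → x ≈ x′ → - x ≈ - x′
  neg-cong {x′ = x′} (k by refl) = (- k) by shift x′ k P
    where
    shift : ∀ x′ k P → - (x′ + k * P) ≡ - x′ + (- k) * P
    shift = solve-∀

  multiple≥p : ∀ {u v n} → + u ≡ + v + +[1+ n ] * P → p ≤ u
  multiple≥p {u} {v} {n} eq = begin
    p               ≤⟨ ℕₚ.m≤n*m p (suc n) ⟩
    suc n ℕ.* p       ≤⟨ ℕₚ.m≤n+m _ v ⟩
    v ℕ.+ suc n ℕ.* p ≡⟨ ℤₚ.+-injective u≡ ⟨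
    u               ∎
    where
    open ℕₚ.≤-Reasoning
    u≡ : + u ≡ + (v ℕ.+ suc n ℕ.* p)
    u≡ = trans eq (trans (cong (_+_ (+ v)) (sym (ℤₚ.pos-* (suc n) p))) (sym (ℤₚ.pos-+ v (suc n ℕ.* p))))

  below-p-injective : ∀ {u v} → u < p → v < p → + u ≈ + v → u ≡ v
  below-p-injective {u} {v} u<p v<p (+ zero by eq) = ℤₚ.+-injective (trans eq (drop (+ v) P))
    where
    drop : ∀ x P → x + 0ℤ * P ≡ x
    drop = solve-∀
  below-p-injective u<p v<p (+[1+ n ] by eq) =
    contradiction (multiple≥p {n = n} eq) (ℕₚ.<⇒≱ u<p)
  below-p-injective {u} {v} u<p v<p (-[1+ n ] by eq) =
    contradiction (multiple≥p {n = n} (flip {k = +[1+ n ]} eq)) (ℕₚ.<⇒≱ v<p)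
    where
    flip : ∀ {x y k} → x ≡ y + (- k) * P → y ≡ x + k * P
    flip {x} {y} {k} refl = shift y k P
      where
      shift : ∀ y k P → y ≡ (y + (- k) * P) + k * P
      shift = solve-∀

  -- The lift F_p → ℤ by representatives 0 ≤ x < p is a ring homomorphism
  -- modulo p, and injective; this transfers identities over ℤ to F_p.
  ι : Fp → ℤ
  ι x = + toℕ x

  ι-red : ∀ n → ι (red n) ≈ + n
  ι-red n = ≈-sym ((+ (n / p)) by n≡)
    where
    n≡ : + n ≡ ι (red n) + + (n / p) * P
    n≡ = begin
      + n                           ≡⟨ cong +_ (m≡m%n+[m/n]*n n p) ⟩
      + (n % p ℕ.+ n / p ℕ.* p)     ≡⟨ ℤₚ.pos-+ (n % p) (n / p ℕ.* p) ⟩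
      + (n % p) + + (n / p ℕ.* p)   ≡⟨ cong₂ _+_ (cong +_ (sym (Finₚ.toℕ-fromℕ< (m%n<n n p))))
                                                 (ℤₚ.pos-* (n / p) p) ⟩
      ι (red n) + + (n / p) * P     ∎
      where open ≡-Reasoning

  ι-+ₚ : ∀ x y → ι (x +ₚ y) ≈ ι x + ι y
  ι-+ₚ x y = ≈-trans (ι-red (toℕ x ℕ.+ toℕ y)) (≡⇒≈ (ℤₚ.pos-+ (toℕ x) (toℕ y)))

  ι-*ₚ : ∀ x y → ι (x *ₚ y) ≈ ι x * ι y
  ι-*ₚ x y = ≈-trans (ι-red (toℕ x ℕ.* toℕ y)) (≡⇒≈ (ℤₚ.pos-* (toℕ x) (toℕ y)))

  ι--ₚ : ∀ x → ι (-ₚ x) ≈ - ι x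
  ι--ₚ x = ≈-trans (ι-red (p ℕ.∸ toℕ x)) (1ℤ by shift (+ (p ℕ.∸ toℕ x)) (ι x) P difference)
    where
    difference : + (p ℕ.∸ toℕ x) + ι x ≡ P
    difference = trans (sym (ℤₚ.pos-+ (p ℕ.∸ toℕ x) (toℕ x)))
                       (cong +_ (ℕₚ.m∸n+n≡m (ℕₚ.<⇒≤ (Finₚ.toℕ<n x))))
    shift : ∀ u t q → u + t ≡ q → u ≡ - t + 1ℤ * q
    shift u t _ refl = rearrange u t
      where
      rearrange : ∀ u t → u ≡ - t + 1ℤ * (u + t)
      rearrange = solve-∀

  ι-injective : ∀ {x y} → ι x ≈ ι y → x ≡ y
  ι-injective {x} {y} ιx≈ιy =
    Finₚ.toℕ-injective (below-p-injective (Finₚ.toℕ<n x) (Finₚ.toℕ<n y) ιx≈ιy)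

  ι-lin : ∀ x y z w → ι ((x *ₚ y) +ₚ (z *ₚ w)) ≈ ι x * ι y + ι z * ι w
  ι-lin x y z w = ≈-trans (ι-+ₚ (x *ₚ y) (z *ₚ w)) (+-cong (ι-*ₚ x y) (ι-*ₚ z w))

  ι-det : ∀ x y z w → ι (det (mat x y z w)) ≈ ι x * ι w - ι y * ι z
  ι-det x y z w = ≈-trans (ι-+ₚ (x *ₚ w) (-ₚ (y *ₚ z)))
                          (+-cong (ι-*ₚ x w) (≈-trans (ι--ₚ (y *ₚ z)) (neg-cong (ι-*ₚ y z))))

  MZ : Set
  MZ = M2 ℤ

  infixl 7 _⊗_
  _⊗_ : MZ → MZ → MZ
  mat a b c d ⊗ mat a′ b′ c′ d′ =
    mat (a * a′ + b * c′) (a * b′ + b * d′) (c * a′ + d * c′) (c * b′ + d * d′)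

  adj : MZ → MZ
  adj (mat a b c d) = mat d (- b) (- c) a

  detℤ : MZ → ℤ
  detℤ (mat a b c d) = a * d - b * c

  scale : ℤ → MZ → MZ
  scale k (mat a b c d) = mat (k * a) (k * b) (k * c) (k * d)

  mat-cong : ∀ {a b c d a′ b′ c′ d′ : ℤ} → a ≡ a′ → b ≡ b′ → c ≡ c′ → d ≡ d′ →
             mat a b c d ≡ mat a′ b′ c′ d′
  mat-cong refl refl refl refl = refl

  adj-⊗ : ∀ A X → adj A ⊗ (A ⊗ X) ≡ scale (detℤ A) X
  adj-⊗ (mat a b c d) (mat x y z w) =
    mat-cong (left a b c d x z) (left a b c d y w) (right a b c d x z) (right a b c d y w)
    where
    left : ∀ a b c d x z → d * (a * x + b * z) + - b * (c * x + d * z) ≡ (a * d - b * c) * x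
    left = solve-∀
    right : ∀ a b c d x z → - c * (a * x + b * z) + a * (c * x + d * z) ≡ (a * d - b * c) * z
    right = solve-∀

  adj-antihom : ∀ A B → adj (A ⊗ B) ≡ adj B ⊗ adj A
  adj-antihom (mat a b c d) (mat x y z w) = mat-cong (e₁ a b c d x y z w) (e₂ a b c d x y z w)
                                                     (e₃ a b c d x y z w) (e₄ a b c d x y z w)
    where
    e₁ : ∀ a b c d x y z w → c * y + d * w ≡ w * d + - y * - c
    e₁ = solve-∀
    e₂ : ∀ a b c d x y z w → - (a * y + b * w) ≡ w * - b + - y * a
    e₂ = solve-∀
    e₃ : ∀ a b c d x y z w → - (c * x + d * z) ≡ - z * d + x * - c
    e₃ = solve-∀
    e₄ : ∀ a b c d x y z w → a * x + b * z ≡ - z * - b + x * a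
    e₄ = solve-∀

  adj-involutive : ∀ A → adj (adj A) ≡ A
  adj-involutive (mat a b c d) = mat-cong refl (ℤₚ.neg-involutive b) (ℤₚ.neg-involutive c) refl

  detℤ-adj : ∀ A → detℤ (adj A) ≡ detℤ A
  detℤ-adj (mat a b c d) = swap a b c d
    where
    swap : ∀ a b c d → d * a - - b * - c ≡ a * d - b * c
    swap = solve-∀

  infix 4 _≈M_
  _≈M_ : MZ → MZ → Set
  mat a b c d ≈M mat a′ b′ c′ d′ = a ≈ a′ × b ≈ b′ × c ≈ c′ × d ≈ d′

  ≈M-refl : ∀ {A} → A ≈M A
  ≈M-refl {mat _ _ _ _} = ≈-refl , ≈-refl , ≈-refl , ≈-refl

  ≈M-sym : ∀ {A B} → A ≈M B → B ≈M A
  ≈M-sym {mat _ _ _ _} {mat _ _ _ _} (e₁ , e₂ , e₃ , e₄) = ≈-sym e₁ , ≈-sym e₂ , ≈-sym e₃ , ≈-sym e₄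

  ≈M-trans : ∀ {A B C} → A ≈M B → B ≈M C → A ≈M C
  ≈M-trans {mat _ _ _ _} {mat _ _ _ _} {mat _ _ _ _} (e₁ , e₂ , e₃ , e₄) (f₁ , f₂ , f₃ , f₄) =
    ≈-trans e₁ f₁ , ≈-trans e₂ f₂ , ≈-trans e₃ f₃ , ≈-trans e₄ f₄

  ≈M-setoid : Setoid _ _
  ≈M-setoid = record { Carrier = MZ ; _≈_ = _≈M_
                     ; isEquivalence = record { refl = ≈M-refl ; sym = ≈M-sym ; trans = ≈M-trans } }

  ⊗-cong : ∀ {A A′ B B′} → A ≈M A′ → B ≈M B′ → A ⊗ B ≈M A′ ⊗ B′
  ⊗-cong {mat _ _ _ _} {mat _ _ _ _} {mat _ _ _ _} {mat _ _ _ _} (e₁ , e₂ , e₃ , e₄) (f₁ , f₂ , f₃ , f₄) =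
    +-cong (*-cong e₁ f₁) (*-cong e₂ f₃) , +-cong (*-cong e₁ f₂) (*-cong e₂ f₄) ,
    +-cong (*-cong e₃ f₁) (*-cong e₄ f₃) , +-cong (*-cong e₃ f₂) (*-cong e₄ f₄)

  adj-cong : ∀ {A B} → A ≈M B → adj A ≈M adj B
  adj-cong {mat _ _ _ _} {mat _ _ _ _} (e₁ , e₂ , e₃ , e₄) = e₄ , neg-cong e₂ , neg-cong e₃ , e₁

  detℤ-cong : ∀ {A B} → A ≈M B → detℤ A ≈ detℤ B
  detℤ-cong {mat _ _ _ _} {mat _ _ _ _} (e₁ , e₂ , e₃ , e₄) =
    +-cong (*-cong e₁ e₄) (neg-cong (*-cong e₂ e₃))

  scale-unit : ∀ {k} A → k ≈ 1ℤ → scale k A ≈M A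
  scale-unit {k} (mat a b c d) k≈1 = unit a , unit b , unit c , unit d
    where
    unit : ∀ x → k * x ≈ x
    unit x = ≈-trans (*-cong k≈1 (≈-refl {x})) (≡⇒≈ (ℤₚ.*-identityˡ x))

  lift : Mat → MZ
  lift (mat a b c d) = mat (ι a) (ι b) (ι c) (ι d)

  lift-· : ∀ X Y → lift (X · Y) ≈M lift X ⊗ lift Y
  lift-· (mat a b c d) (mat x y z w) = ι-lin a x b z , ι-lin a y b w , ι-lin c x d z , ι-lin c y d w

  lift-inv : ∀ X → lift (inv X) ≈M adj (lift X)
  lift-inv (mat a b c d) = ≈-refl , ι--ₚ b , ι--ₚ c , ≈-refl

  lift-det : ∀ X → ι (det X) ≈ detℤ (lift X)
  lift-det (mat a b c d) = ι-det a b c d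

  lift-injective : ∀ {X Y} → lift X ≈M lift Y → X ≡ Y
  lift-injective {mat _ _ _ _} {mat _ _ _ _} (e₁ , e₂ , e₃ , e₄) =
    cong₂ (λ (a , b) (c , d) → mat a b c d) (cong₂ _,_ (ι-injective e₁) (ι-injective e₂))
                                            (cong₂ _,_ (ι-injective e₃) (ι-injective e₄))

  module ≈-Reasoning = SetoidReasoning ≈-setoid
  module ≈M-Reasoning = SetoidReasoning ≈M-setoid

  inv-involutive : ∀ X → inv (inv X) ≡ X
  inv-involutive X = lift-injective (begin
    lift (inv (inv X)) ≈⟨ lift-inv (inv X) ⟩
    adj (lift (inv X)) ≈⟨ adj-cong (lift-inv X) ⟩
    adj (adj (lift X)) ≡⟨ adj-involutive (lift X) ⟩
    lift X             ∎)
    where open ≈M-Reasoning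

  -- the energy equation for an element of Λ⁻¹, written for its inverse
  cancel-inv-inv : ∀ {X X′ Z Z′} → inv (inv X) · Z ≡ inv (inv X′) · Z′ → X · Z ≡ X′ · Z′
  cancel-inv-inv {X} {X′} {Z} {Z′} = subst₂ (λ W W′ → W · Z ≡ W′ · Z′) (inv-involutive X) (inv-involutive X′)

  inv-· : ∀ X Y → inv (X · Y) ≡ inv Y · inv X
  inv-· X Y = lift-injective (begin
    lift (inv (X · Y))          ≈⟨ lift-inv (X · Y) ⟩
    adj (lift (X · Y))          ≈⟨ adj-cong (lift-· X Y) ⟩
    adj (lift X ⊗ lift Y)       ≡⟨ adj-antihom (lift X) (lift Y) ⟩
    adj (lift Y) ⊗ adj (lift X) ≈⟨ ⊗-cong (lift-inv Y) (lift-inv X) ⟨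
    lift (inv Y) ⊗ lift (inv X) ≈⟨ lift-· (inv Y) (inv X) ⟨
    lift (inv Y · inv X)        ∎)
    where open ≈M-Reasoning

  det-inv : ∀ X → det (inv X) ≡ det X
  det-inv X = ι-injective {det (inv X)} {det X} (begin
    ι (det (inv X))     ≈⟨ lift-det (inv X) ⟩
    detℤ (lift (inv X)) ≈⟨ detℤ-cong (lift-inv X) ⟩
    detℤ (adj (lift X)) ≡⟨ detℤ-adj (lift X) ⟩
    detℤ (lift X)       ≈⟨ lift-det X ⟨
    ι (det X)           ∎)
    where open ≈-Reasoning

  SL2-inv : ∀ {X} → SL2 X → SL2 (inv X)
  SL2-inv {X} det≡1 = trans (det-inv X) det≡1

  SL2-detℤ : ∀ {A} → SL2 A → detℤ (lift A) ≈ 1ℤ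
  SL2-detℤ {A} det≡1 = begin
    detℤ (lift A) ≈⟨ lift-det A ⟨
    ι (det A)     ≡⟨ cong ι det≡1 ⟩
    ι 1ₚ          ≈⟨ ι-red 1 ⟩
    1ℤ            ∎
    where open ≈-Reasoning

  cancelˡ : ∀ {A X Y} → SL2 A → A · X ≡ A · Y → X ≡ Y
  cancelˡ {A} {X} {Y} A∈SL2 AX≡AY = lift-injective (begin
    lift X                           ≈⟨ scale-unit (lift X) (SL2-detℤ {A} A∈SL2) ⟨
    scale (detℤ (lift A)) (lift X)   ≡⟨ adj-⊗ (lift A) (lift X) ⟨
    adj (lift A) ⊗ (lift A ⊗ lift X) ≈⟨ ⊗-cong (≈M-refl {adj (lift A)}) (lift-· A X) ⟨
    adj (lift A) ⊗ lift (A · X)      ≡⟨ cong (λ B → adj (lift A) ⊗ lift B) AX≡AY ⟩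
    adj (lift A) ⊗ lift (A · Y)      ≈⟨ ⊗-cong (≈M-refl {adj (lift A)}) (lift-· A Y) ⟩
    adj (lift A) ⊗ (lift A ⊗ lift Y) ≡⟨ adj-⊗ (lift A) (lift Y) ⟩
    scale (detℤ (lift A)) (lift Y)   ≈⟨ scale-unit (lift Y) (SL2-detℤ {A} A∈SL2) ⟩
    lift Y                           ∎)
    where open ≈M-Reasoning

  inverted-equation : ∀ {X Y X′ Y′} → X · Y ≡ X′ · Y′ → inv Y · inv X ≡ inv Y′ · inv X′
  inverted-equation {X} {Y} {X′} {Y′} eq = trans (sym (inv-· X Y)) (trans (cong inv eq) (inv-· X′ Y′))

  inv-injective : ∀ {X Y} → inv X ≡ inv Y → X ≡ Y
  inv-injective {X} {Y} eq = trans (sym (inv-involutive X)) (trans (cong inv eq) (inv-involutive Y))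

  cancelʳ : ∀ {A X Y} → SL2 A → X · A ≡ Y · A → X ≡ Y
  cancelʳ {A} {X} {Y} A∈SL2 XA≡YA =
    inv-injective {X} {Y} (cancelˡ {inv A} (SL2-inv {A} A∈SL2) (inverted-equation {X} {A} {Y} {A} XA≡YA))

  Borel-inv : ∀ {X} → Borel X → Borel (inv X)
  Borel-inv {X} (det≡1 , c≡0) = SL2-inv {X} det≡1 , trans (cong -ₚ_ c≡0) -0ₚ
    where
    -0ₚ : -ₚ 0ₚ ≡ 0ₚ
    -0ₚ = ι-injective { -ₚ 0ₚ} {0ₚ} (≈-trans (ι--ₚ 0ₚ) (≈-trans (neg-cong (ι-red 0)) (≈-sym (ι-red 0))))

  proportional : ∀ s s′ t t′ u u′ v v′ → s * u ≈ s′ * u′ → s * v ≈ s′ * v′ →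
                 t * s ≈ 1ℤ → t′ * s′ ≈ 1ℤ → u * v′ ≈ u′ * v
  proportional s s′ t t′ u u′ v v′ su≈ sv≈ ts≈1 t′s′≈1 = begin
    u * v′                                   ≡⟨ ℤₚ.*-identityʳ (u * v′) ⟨
    (u * v′) * 1ℤ                            ≈⟨ *-cong (≈-refl {u * v′}) units ⟨
    (u * v′) * ((t * s) * (t′ * s′))         ≡⟨ regroup u v′ t s t′ s′ ⟩
    (t * t′) * ((s * u) * (s′ * v′))         ≈⟨ *-cong (≈-refl {t * t′}) (*-cong su≈ (≈-sym sv≈)) ⟩
    (t * t′) * ((s′ * u′) * (s * v))         ≡⟨ regroup′ u′ v t s t′ s′ ⟩
    (u′ * v) * ((t * s) * (t′ * s′))         ≈⟨ *-cong (≈-refl {u′ * v}) units ⟩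
    (u′ * v) * 1ℤ                            ≡⟨ ℤₚ.*-identityʳ (u′ * v) ⟩
    u′ * v                                   ∎
    where
    open ≈-Reasoning
    units : (t * s) * (t′ * s′) ≈ 1ℤ
    units = *-cong ts≈1 t′s′≈1
    regroup : ∀ u v′ t s t′ s′ → (u * v′) * ((t * s) * (t′ * s′)) ≡ (t * t′) * ((s * u) * (s′ * v′))
    regroup = solve-∀
    regroup′ : ∀ u′ v t s t′ s′ → (t * t′) * ((s′ * u′) * (s * v)) ≡ (u′ * v) * ((t * s) * (t′ * s′))
    regroup′ = solve-∀

  ι-zero : ∀ {x} → x ≡ 0ₚ → ι x ≈ 0ℤ
  ι-zero refl = ι-red 0

  Borel-diagonal : ∀ {Z} → Borel Z → ι (a Z) * ι (d Z) ≈ 1ℤ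
  Borel-diagonal {Z} (det≡1 , c≡0) = begin
    ι (a Z) * ι (d Z)
      ≡⟨ add-sub (ι (a Z) * ι (d Z)) (ι (b Z) * ι (c Z)) ⟩
    (ι (a Z) * ι (d Z) - ι (b Z) * ι (c Z)) + ι (b Z) * ι (c Z)
      ≈⟨ +-cong (SL2-detℤ {Z} det≡1) (*-cong (≈-refl {ι (b Z)}) (ι-zero c≡0)) ⟩
    1ℤ + ι (b Z) * 0ℤ
      ≡⟨ cong (_+_ 1ℤ) (ℤₚ.*-zeroʳ (ι (b Z))) ⟩
    1ℤ
      ∎
    where
    open ≈-Reasoning
    add-sub : ∀ x y → x ≡ (x - y) + y
    add-sub = solve-∀

  ι-lin-zeroʳ : ∀ x y z {w} → w ≡ 0ₚ → ι ((x *ₚ y) +ₚ (z *ₚ w)) ≈ ι y * ι x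
  ι-lin-zeroʳ x y z {w} w≡0 = begin
    ι ((x *ₚ y) +ₚ (z *ₚ w)) ≈⟨ ι-lin x y z w ⟩
    ι x * ι y + ι z * ι w    ≈⟨ +-cong (≈-refl {ι x * ι y}) (*-cong (≈-refl {ι z}) (ι-zero w≡0)) ⟩
    ι x * ι y + ι z * 0ℤ     ≡⟨ drop (ι x) (ι y) (ι z) ⟩
    ι y * ι x                ∎
    where
    open ≈-Reasoning
    drop : ∀ x y z → x * y + z * 0ℤ ≡ y * x
    drop = solve-∀

  ι-lin-zeroˡ : ∀ {x} y z w → x ≡ 0ₚ → ι ((x *ₚ y) +ₚ (z *ₚ w)) ≈ ι z * ι w
  ι-lin-zeroˡ {x} y z w x≡0 = begin
    ι ((x *ₚ y) +ₚ (z *ₚ w)) ≈⟨ ι-lin x y z w ⟩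
    ι x * ι y + ι z * ι w    ≈⟨ +-cong (*-cong (ι-zero x≡0) (≈-refl {ι y})) (≈-refl {ι z * ι w}) ⟩
    0ℤ * ι y + ι z * ι w     ≡⟨ drop (ι y) (ι z * ι w) ⟩
    ι z * ι w                ∎
    where
    open ≈-Reasoning
    drop : ∀ y u → 0ℤ * y + u ≡ u
    drop = solve-∀

  ι-cross : ∀ x y x′ y′ → ι x * ι y ≈ ι x′ * ι y′ → x *ₚ y ≡ x′ *ₚ y′
  ι-cross x y x′ y′ cross =
    ι-injective {x *ₚ y} {x′ *ₚ y′} (≈-trans (ι-*ₚ x y) (≈-trans cross (≈-sym (ι-*ₚ x′ y′))))

  same-entry : ∀ {M N u u′} (f : Mat → Fp) → M ≡ N → ι (f M) ≈ u → ι (f N) ≈ u′ → u ≈ u′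
  same-entry f refl e e′ = ≈-trans (≈-sym e) e′

  -- Right multiplication by an element of B rescales the first column, so
  -- Y Z = Y′ Z′ with Z, Z′ ∈ B makes the first columns of Y, Y′ proportional.
  first-column-proportional : ∀ {Y Y′ Z Z′} → Borel Z → Borel Z′ → Y · Z ≡ Y′ · Z′ →
                              a Y *ₚ c Y′ ≡ a Y′ *ₚ c Y
  first-column-proportional {Y} {Y′} {Z} {Z′} Z∈B Z′∈B YZ≡Y′Z′ =
    ι-cross (a Y) (c Y′) (a Y′) (c Y) (proportional
      (ι (a Z)) (ι (a Z′)) (ι (d Z)) (ι (d Z′)) (ι (a Y)) (ι (a Y′)) (ι (c Y)) (ι (c Y′))
      (same-entry a YZ≡Y′Z′ (ι-lin-zeroʳ (a Y) (a Z) (b Y) (proj₂ Z∈B))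
                            (ι-lin-zeroʳ (a Y′) (a Z′) (b Y′) (proj₂ Z′∈B)))
      (same-entry c YZ≡Y′Z′ (ι-lin-zeroʳ (c Y) (a Z) (d Y) (proj₂ Z∈B))
                            (ι-lin-zeroʳ (c Y′) (a Z′) (d Y′) (proj₂ Z′∈B)))
      (unit {Z} Z∈B) (unit {Z′} Z′∈B))
    where
    unit : ∀ {W} → Borel W → ι (d W) * ι (a W) ≈ 1ℤ
    unit {W} W∈B = ≈-trans (≡⇒≈ (ℤₚ.*-comm (ι (d W)) (ι (a W)))) (Borel-diagonal {W} W∈B)

  -- Left multiplication by an element of B rescales the bottom row, so
  -- Z Y = Z′ Y′ with Z, Z′ ∈ B makes the bottom rows of Y, Y′ proportional.
  bottom-row-proportional : ∀ {Y Y′ Z Z′} → Borel Z → Borel Z′ → Z · Y ≡ Z′ · Y′ →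
                            c Y *ₚ d Y′ ≡ c Y′ *ₚ d Y
  bottom-row-proportional {Y} {Y′} {Z} {Z′} Z∈B Z′∈B ZY≡Z′Y′ =
    ι-cross (c Y) (d Y′) (c Y′) (d Y) (proportional
      (ι (d Z)) (ι (d Z′)) (ι (a Z)) (ι (a Z′)) (ι (c Y)) (ι (c Y′)) (ι (d Y)) (ι (d Y′))
      (same-entry c ZY≡Z′Y′ (ι-lin-zeroˡ (a Y) (d Z) (c Y) (proj₂ Z∈B))
                            (ι-lin-zeroˡ (a Y′) (d Z′) (c Y′) (proj₂ Z′∈B)))
      (same-entry d ZY≡Z′Y′ (ι-lin-zeroˡ (b Y) (d Z) (d Y) (proj₂ Z∈B))
                            (ι-lin-zeroˡ (b Y′) (d Z′) (d Y′) (proj₂ Z′∈B)))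
      (Borel-diagonal {Z} Z∈B) (Borel-diagonal {Z′} Z′∈B))

  red-cross : ∀ u v u′ v′ → u ℕ.* v < p → u′ ℕ.* v′ < p →
              red u *ₚ red v ≡ red u′ *ₚ red v′ → u ℕ.* v ≡ u′ ℕ.* v′
  red-cross u v u′ v′ uv<p u′v′<p cross = below-p-injective uv<p u′v′<p (begin
    + (u ℕ.* v)               ≡⟨ ℤₚ.pos-* u v ⟩
    + u * + v                 ≈⟨ *-cong (ι-red u) (ι-red v) ⟨
    ι (red u) * ι (red v)     ≈⟨ ι-*ₚ (red u) (red v) ⟨
    ι (red u *ₚ red v)        ≡⟨ cong ι cross ⟩
    ι (red u′ *ₚ red v′)      ≈⟨ ι-*ₚ (red u′) (red v′) ⟩
    ι (red u′) * ι (red v′)   ≈⟨ *-cong (ι-red u′) (ι-red v′) ⟩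
    + u′ * + v′               ≡⟨ ℤₚ.pos-* u′ v′ ⟨
    + (u′ ℕ.* v′)             ∎)
    where open ≈-Reasoning

  red-SL2 : ∀ {a b c d} → a ℕ.* d ≡ b ℕ.* c ℕ.+ 1 → SL2 (redMat (mat a b c d))
  red-SL2 {a} {b} {c} {d} det≡1 = ι-injective {det (redMat (mat a b c d))} {1ₚ} (begin
    ι (det (redMat (mat a b c d)))                  ≈⟨ ι-det (red a) (red b) (red c) (red d) ⟩
    ι (red a) * ι (red d) - ι (red b) * ι (red c)   ≈⟨ +-cong (*-cong (ι-red a) (ι-red d))
                                                              (neg-cong (*-cong (ι-red b) (ι-red c))) ⟩
    + a * + d - + b * + c                           ≡⟨ cong₂ _-_ (ℤₚ.pos-* a d) (ℤₚ.pos-* b c) ⟨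
    + (a ℕ.* d) - + (b ℕ.* c)                       ≡⟨ cong (λ n → + n - + (b ℕ.* c)) det≡1 ⟩
    + (b ℕ.* c ℕ.+ 1) - + (b ℕ.* c)                 ≡⟨ cong (_- + (b ℕ.* c)) (ℤₚ.pos-+ (b ℕ.* c) 1) ⟩
    (+ (b ℕ.* c) + 1ℤ) - + (b ℕ.* c)                ≡⟨ cancel (+ (b ℕ.* c)) ⟩
    1ℤ                                              ≈⟨ ι-red 1 ⟨
    ι 1ₚ                                            ∎)
    where
    open ≈-Reasoning
    cancel : ∀ x → (x + 1ℤ) - x ≡ 1ℤ
    cancel = solve-∀

open Counting
open ContinuedFractions

open import Data.Nat using (ℕ; suc; _*_; _^_; _≤_; _<_; NonZero; >-nonZero⁻¹)
import Data.Nat.Properties as ℕₚ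
open import Data.Nat.Primality using (Prime; prime⇒nonZero)
open import Data.List using (List; length)
import Data.List.Relation.Unary.All as All
open import Data.Product using (_×_; _,_; proj₁; proj₂)
open import Data.Sum using (inj₁; inj₂)
open import Relation.Binary.PropositionalEquality
open import Function using (_∘_)
open import Data.Nat.Coprimality using (Coprime)
import Data.Nat.Coprimality as Coprime

geometric-mean : ∀ {n} x y → x * x ≤ n → y * y ≤ n → x * y ≤ n
geometric-mean x y x²≤n y²≤n with ℕₚ.≤-total x y
... | inj₁ x≤y = ℕₚ.≤-trans (ℕₚ.*-monoˡ-≤ y x≤y) y²≤n
... | inj₂ y≤x = ℕₚ.≤-trans (ℕₚ.*-monoʳ-≤ x y≤x) x²≤n

module Continuants (p : ℕ) (pp : Prime p) (M : ℕ) where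
  open OverFp p pp
  open Residues p pp

  code : List ℕ → Mat
  code bs = redMat (cfProd bs)

  code≡ : ∀ bs → code bs ≡ redMat (cf bs)
  code≡ bs = cong redMat (cfProd≡cf bs)

  positive : ∀ {bs} → Admissible M bs → Positive bs
  positive (bounds , _ , _) = All.map proj₁ bounds

  even : ∀ {bs} → Admissible M bs → Even (length bs)
  even (_ , even , _) = even

  q²≤Q : ∀ {bs} → Admissible M bs → d (cf bs) * d (cf bs) ≤ Q
  q²≤Q {bs} (_ , _ , q²≤Q) = subst (λ N → d N * d N ≤ Q) (cfProd≡cf bs) q²≤Q

  private
    instance
      p≢0 : NonZero p
      p≢0 = prime⇒nonZero pp

  Q<p : Q < p
  Q<p = subst (Q <_) (trans (ℕₚ.+-comm 1 Q) (ℕₚ.m∸n+n≡m (>-nonZero⁻¹ p))) (ℕₚ.n<1+n Q)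

  small-product : ∀ {bs bs′ u v} → Admissible M bs → Admissible M bs′ →
                  u ≤ d (cf bs) → v ≤ d (cf bs′) → u * v < p
  small-product {bs} {bs′} {u} {v} adm adm′ u≤q v≤q′ = begin-strict
    u * v                 ≤⟨ ℕₚ.*-mono-≤ u≤q v≤q′ ⟩
    d (cf bs) * d (cf bs′) ≤⟨ geometric-mean (d (cf bs)) (d (cf bs′)) (q²≤Q adm) (q²≤Q adm′) ⟩
    Q                     <⟨ Q<p ⟩
    p                     ∎
    where
    open ℕₚ.≤-Reasoning

  -- Λ ⊆ SL_2(F_p), as an even-length expansion has determinant 1
  Λ-SL2 : ∀ {bs} → Admissible M bs → SL2 (code bs)
  Λ-SL2 {bs} adm = subst SL2 (sym (code≡ bs)) (red-SL2 (cf-det bs (even adm)))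

  bottom-row-coprime : ∀ {bs} → Admissible M bs → Coprime (c (cf bs)) (d (cf bs))
  bottom-row-coprime {bs} adm = Coprime.sym (unimodular⇒coprime {a (cf bs)} {b (cf bs)} (cf-det bs (even adm)))

  first-column-coprime : ∀ {bs} → Admissible M bs → Coprime (a (cf bs)) (c (cf bs))
  first-column-coprime {bs} adm =
    unimodular⇒coprime {d (cf bs)} {b (cf bs)} (trans (ℕₚ.*-comm (d (cf bs)) (a (cf bs))) (cf-det bs (even adm)))

  -- If the bottom rows of two matrices in Λ are proportional, the
  -- expansions coincide: the entries are below √p, so the proportionality
  -- holds over ℤ, and the rows are primitive.
  Λ-bottom-row : ∀ {bs bs′} → Admissible M bs → Admissible M bs′ →
                 c (code bs) *ₚ d (code bs′) ≡ c (code bs′) *ₚ d (code bs) → bs ≡ bs′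
  Λ-bottom-row {bs} {bs′} adm adm′ cross =
    bottom-row-determines bs bs′ (positive adm) (positive adm′) (even adm) (even adm′)
      (cong₂ _,_ (proj₁ rows) (proj₂ rows))
    where
    N N′ : M2 ℕ
    N = cf bs
    N′ = cf bs′
    cross-ℕ : c N * d N′ ≡ c N′ * d N
    cross-ℕ = red-cross (c N) (d N′) (c N′) (d N)
      (small-product adm adm′ (proj₂ (cf-entries≤q bs (positive adm))) ℕₚ.≤-refl)
      (small-product adm′ adm (proj₂ (cf-entries≤q bs′ (positive adm′))) ℕₚ.≤-refl)
      (subst₂ (λ G G′ → c G *ₚ d G′ ≡ c G′ *ₚ d G) (code≡ bs) (code≡ bs′) cross)
    rows : c N ≡ c N′ × d N ≡ d N′
    rows = coprime-proportional (bottom-row-coprime adm) (bottom-row-coprime adm′) cross-ℕ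

  Λ-first-column : ∀ {bs bs′} → Admissible M bs → Admissible M bs′ →
                   a (code bs) *ₚ c (code bs′) ≡ a (code bs′) *ₚ c (code bs) →
                   column (1 , 0) bs ≡ column (1 , 0) bs′
  Λ-first-column {bs} {bs′} adm adm′ cross = cong₂ _,_ (proj₁ cols) (proj₂ cols)
    where
    N N′ : M2 ℕ
    N = cf bs
    N′ = cf bs′
    cross-ℕ : a N * c N′ ≡ a N′ * c N
    cross-ℕ = red-cross (a N) (c N′) (a N′) (c N)
      (small-product adm adm′ (proj₁ (cf-entries≤q bs (positive adm))) (proj₂ (cf-entries≤q bs′ (positive adm′))))
      (small-product adm′ adm (proj₁ (cf-entries≤q bs′ (positive adm′))) (proj₂ (cf-entries≤q bs (positive adm))))
      (subst₂ (λ G G′ → a G *ₚ c G′ ≡ a G′ *ₚ c G) (code≡ bs) (code≡ bs′) cross)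
    cols : a N ≡ a N′ × c N ≡ c N′
    cols = coprime-proportional (first-column-coprime adm) (first-column-coprime adm′) cross-ℕ

  -- Unique factorisation in BΛ: left multiplication by B rescales the
  -- bottom row, which determines an element of Λ.
  BΛ-unique : ∀ {z z′ g g′} → Borel z → Borel z′ → Λ M g → Λ M g′ →
              z · g ≡ z′ · g′ → z ≡ z′ × g ≡ g′
  BΛ-unique {z} {z′} z∈B z′∈B (bs , adm , refl) (bs′ , adm′ , refl) eq =
    cancelʳ {code bs} (Λ-SL2 adm) (trans eq (cong (z′ ·_) (sym g≡g′))) , g≡g′
    where
    g≡g′ : code bs ≡ code bs′
    g≡g′ = cong code (Λ-bottom-row adm adm′ (bottom-row-proportional {code bs} {code bs′} {z} {z′} z∈B z′∈B eq))

  -- Factorisations g z = g′ z′ in ΛB are told apart by the last partial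
  -- quotient of g: right multiplication by B rescales the first column,
  -- which determines the expansion up to its last quotient.
  ΛB-fibre : ∀ {bs bs′ z z′} → Admissible M bs → Admissible M bs′ → Borel z → Borel z′ →
             code bs · z ≡ code bs′ · z′ → lastIndex bs ≡ lastIndex bs′ → bs ≡ bs′ × z ≡ z′
  ΛB-fibre {bs} {bs′} {z} {z′} adm adm′ z∈B z′∈B eq last =
    bs≡bs′ , cancelˡ {code bs} (Λ-SL2 adm) (trans eq (cong (λ l → code l · z′) (sym bs≡bs′)))
    where
    bs≡bs′ : bs ≡ bs′
    bs≡bs′ = first-column-determines bs bs′ (positive adm) (positive adm′) (even adm) (even adm′)
               (Λ-first-column adm adm′ (first-column-proportional {code bs} {code bs′} {z} {z′} z∈B z′∈B eq)) last

  -- The energy equation y⁻¹ z = y₁⁻¹ z₁ with y, y₁ ∈ Λ and z, z₁ ∈ B has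
  -- only the diagonal solutions: inverted, it reads z⁻¹ y = z₁⁻¹ y₁ in BΛ.
  energy-diagonal : ∀ {y y₁ z z₁} → Λ M y → Λ M y₁ → Borel z → Borel z₁ →
                    inv y · z ≡ inv y₁ · z₁ → y ≡ y₁ × z ≡ z₁
  energy-diagonal {y} {y₁} {z} {z₁} y∈Λ y₁∈Λ z∈B z₁∈B eq =
    proj₂ factors , inv-injective {z} {z₁} (proj₁ factors)
    where
    inverted : inv z · y ≡ inv z₁ · y₁
    inverted = subst₂ (λ w w₁ → inv z · w ≡ inv z₁ · w₁) (inv-involutive y) (inv-involutive y₁)
                      (inverted-equation {inv y} {z} {inv y₁} {z₁} eq)
    factors : inv z ≡ inv z₁ × y ≡ y₁
    factors = BΛ-unique (Borel-inv {z} z∈B) (Borel-inv {z₁} z₁∈B) y∈Λ y₁∈Λ inverted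

  open _↪_

  module _ (X : Mat → Set) (X⊆B : ∀ g → X g → Borel g) where

    Λ-energy↪ : EnergySet (Λ M) X ↪ (Λ M ⊠ X)
    Λ-energy↪ .to (y , _ , z , _) _ = y , z
    Λ-energy↪ .to-∈ _ (y∈Λ , _ , z∈X , _) = y∈Λ , z∈X
    Λ-energy↪ .injective {y , y₁ , z , z₁} {_ , y₁′ , _ , z₁′}
                         (y∈Λ , y₁∈Λ , z∈X , z₁∈X , eq) (_ , y₁′∈Λ , _ , z₁′∈X , eq′) refl =
      cong₂ (λ w w′ → y , w , z , w′) (trans (sym (proj₁ diagonal)) (proj₁ diagonal′))
                                      (trans (sym (proj₂ diagonal)) (proj₂ diagonal′))
      where
      diagonal : y ≡ y₁ × z ≡ z₁
      diagonal = energy-diagonal {y} {y₁} {z} {z₁} y∈Λ y₁∈Λ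
                   (X⊆B z z∈X) (X⊆B z₁ z₁∈X) eq
      diagonal′ : y ≡ y₁′ × z ≡ z₁′
      diagonal′ = energy-diagonal {y} {y₁′} {z} {z₁′} y∈Λ y₁′∈Λ
                    (X⊆B z z∈X) (X⊆B z₁′ z₁′∈X) eq′

    diagonal↪ : (Λ M ⊠ X) ↪ EnergySet (Λ M) X
    diagonal↪ .to (y , z) _ = y , y , z , z
    diagonal↪ .to-∈ _ (y∈Λ , z∈X) = y∈Λ , y∈Λ , z∈X , z∈X , refl
    diagonal↪ .injective _ _ refl = refl

    -- A solution of g z = g₁ z₁ (the Λ⁻¹-energy equation) is determined
    -- by g, z and the last partial quotient of g₁.
    Λ⁻¹-energy↪ : 1 ≤ M → EnergySet (InvSet (Λ M)) X ↪ ((_< M) ⊠ (Λ M ⊠ X))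
    Λ⁻¹-energy↪ _   .to (_ , _ , z , _) ((g , _) , (_ , (bs₁ , _) , _) , _) = lastIndex bs₁ , g , z
    Λ⁻¹-energy↪ 1≤M .to-∈ _ ((_ , g∈Λ , _) , (_ , (bs₁ , adm₁ , _) , _) , z∈X , _) =
      lastIndex<M bs₁ 1≤M (proj₁ adm₁) , g∈Λ , z∈X
    Λ⁻¹-energy↪ _   .injective {_ , _ , z , z₁} {_ , _ , z′ , z₁′}
        ((g , _ , refl) , (_ , (bs₁ , adm₁ , refl) , refl) , _ , z₁∈X , eq)
        ((g′ , _ , refl) , (_ , (bs₁′ , adm₁′ , refl) , refl) , _ , z₁′∈X , eq′) images =
      cong₂ _,_ (cong inv g≡g′)
                (cong₂ _,_ (cong (inv ∘ code) (proj₁ fibre)) (cong₂ _,_ z≡z′ (proj₂ fibre)))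
      where
      g≡g′ : g ≡ g′
      g≡g′ = cong (proj₁ ∘ proj₂) images
      z≡z′ : z ≡ z′
      z≡z′ = cong (proj₂ ∘ proj₂) images
      fibre : bs₁ ≡ bs₁′ × z₁ ≡ z₁′
      fibre = ΛB-fibre {bs₁} {bs₁′} {z₁} {z₁′} adm₁ adm₁′ (X⊆B z₁ z₁∈X) (X⊆B z₁′ z₁′∈X)
                (trans (sym (cancel-inv-inv {g} {code bs₁} {z} {z₁} eq))
                       (trans (cong₂ _·_ g≡g′ z≡z′) (cancel-inv-inv {g′} {code bs₁′} {z′} {z₁′} eq′)))
                (cong proj₁ images)

  BΛ↪ : ProdSet Borel (Λ M) ↪ (Borel ⊠ Λ M)
  BΛ↪ .to _ (z , g , _) = z , g
  BΛ↪ .to-∈ _ (_ , _ , z∈B , g∈Λ , _) = z∈B , g∈Λ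
  BΛ↪ .injective (_ , _ , _ , _ , refl) (_ , _ , _ , _ , refl) refl = refl

  B×Λ↪BΛ : (Borel ⊠ Λ M) ↪ ProdSet Borel (Λ M)
  B×Λ↪BΛ .to (z , g) _ = z · g
  B×Λ↪BΛ .to-∈ (z , g) (z∈B , g∈Λ) = z , g , z∈B , g∈Λ , refl
  B×Λ↪BΛ .injective {z , g} {z′ , g′} (z∈B , g∈Λ) (z′∈B , g′∈Λ) eq =
    cong₂ _,_ (proj₁ factors) (proj₂ factors)
    where
    factors : z ≡ z′ × g ≡ g′
    factors = BΛ-unique {z} {z′} {g} {g′} z∈B z′∈B g∈Λ g′∈Λ eq

  B×Λ↪ΛB : 1 ≤ M → (Borel ⊠ Λ M) ↪ ((_< M) ⊠ ProdSet (Λ M) Borel)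
  B×Λ↪ΛB _   .to (z , g) (_ , bs , _) = lastIndex bs , g · z
  B×Λ↪ΛB 1≤M .to-∈ (z , g) (z∈B , g∈Λ@(bs , adm , _)) =
    lastIndex<M bs 1≤M (proj₁ adm) , g , z , g∈Λ , z∈B , refl
  B×Λ↪ΛB _   .injective {z , _} {z′ , _} (z∈B , bs , adm , refl) (z′∈B , bs′ , adm′ , refl) images =
    cong₂ _,_ (proj₂ fibre) (cong code (proj₁ fibre))
    where
    fibre : bs ≡ bs′ × z ≡ z′
    fibre = ΛB-fibre {bs} {bs′} {z} {z′} adm adm′ z∈B z′∈B (cong proj₂ images) (cong proj₁ images)

-- M ≤ M⁴ for M ≥ 1, which turns the bounds with factor M into the stated ones.
≤-M⁴ : ∀ {M n e} → 1 ≤ M → e ≤ M * n → e ≤ M ^ 4 * n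
≤-M⁴ {suc m} {n} _ e≤ = ℕₚ.≤-trans e≤ (ℕₚ.*-monoˡ-≤ n (ℕₚ.m≤m*n (suc m) (suc m ^ 3)))
  where instance _ = ℕₚ.m^n≢0 (suc m) 3

lemma7 : (p : ℕ) (pp : Prime p) (M : ℕ) → 1 ≤ M →
         (X : OverFp.Mat p pp → Set) → (∀ g → X g → OverFp.Borel p pp g) →
         (nΛ nB nX : ℕ) →
         Card (OverFp.Λ p pp M) nΛ → Card (OverFp.Borel p pp) nB → Card X nX →
         (∀ e → Card (OverFp.EnergySet p pp (OverFp.Λ p pp M) X) e → e ≡ nΛ * nX)
         × (∀ e → Card (OverFp.EnergySet p pp (OverFp.InvSet p pp (OverFp.Λ p pp M)) X) e →
              e ≤ M ^ 4 * nΛ * nX)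
         × (∀ k → Card (OverFp.ProdSet p pp (OverFp.Borel p pp) (OverFp.Λ p pp M)) k →
              k ≡ nB * nΛ)
         × (∀ k → Card (OverFp.ProdSet p pp (OverFp.Λ p pp M) (OverFp.Borel p pp)) k →
              nB * nΛ ≤ M ^ 4 * k)
-- Each claim compares cardinalities along the injections of Continuants:
-- the first and third in both directions, the others with the factor M.
lemma7 p pp M 1≤M X X⊆B nΛ nB nX |Λ| |B| |X| =
  (λ _ |E| → ℕₚ.≤-antisym (card-mono (Λ-energy↪ X X⊆B) |E| |Λ×X|)
                          (card-mono (diagonal↪ X X⊆B) |Λ×X| |E|)) ,
  (λ e |E| → subst (e ≤_) (sym (ℕₚ.*-assoc (M ^ 4) nΛ nX))
                  (≤-M⁴ 1≤M (card-mono (Λ⁻¹-energy↪ X X⊆B 1≤M) |E| (card-⊠ (card-below M) |Λ×X|)))) ,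
  (λ _ |BΛ| → ℕₚ.≤-antisym (card-mono BΛ↪ |BΛ| |B×Λ|) (card-mono B×Λ↪BΛ |B×Λ| |BΛ|)) ,
  (λ _ |ΛB| → ≤-M⁴ 1≤M (card-mono (B×Λ↪ΛB 1≤M) |B×Λ| (card-⊠ (card-below M) |ΛB|)))
  where
  open Continuants p pp M
  |Λ×X| : Card (OverFp.Λ p pp M ⊠ X) (nΛ * nX)
  |Λ×X| = card-⊠ |Λ| |X|
  |B×Λ| : Card (OverFp.Borel p pp ⊠ OverFp.Λ p pp M) (nB * nΛ)
  |B×Λ| = card-⊠ |B| |Λ|
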